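{- Let $G=(A,B,E)$ be a bipartite graph with a proper edge coloring $\chi:E\to\{1,\dots,d\}$, $d\ge2$, let $G'=(A,B,E')$ be the output (for any outcome of the random choices) of reversed thinning of $G$, let $\chi'$ be the type edge coloring of $G'$, and let $k\ge2$. If a subgraph $G''=(A,B,E'')$ of $G'$, with edge coloring $\chi'$, has no $(k',A)$-slow walk for any $2\le k'<k$, then $G''$ with edge coloring $\chi$ has no $k$-fast walk.
   Context: A bipartite graph is a triple $G=(A,B,E)$ with disjoint $A,B$ and $E\subseteq A\times B$, edges written $(x,y)$ with $x\in A$, $y\in B$. A walk of length $m$ is $v_0,\dots,v_m$ with consecutive vertices adjacent and $v_{i-2}\ne v_i$; its coloring is the sequence of its edge colors. For $k\ge2$, a $k$-fast walk is a walk of length $2k$ (starting on either side) whose coloring satisfies $c_1>c_2>\dots>c_k<c_{k+1}<\dots<c_{2k}$ and $c_1\ge c_{2k}$. For $k\ge2$, a $k$-slow walk is a walk of length $2k$ whose coloring satisfies: $c_{2j-1}>c_{2j}$ for $1\le j\le k/2$; $c_{2j}<c_{2j+1}$ for $1\le j<k/2$; $c_{2j-1}<c_{2j}$ for $k/2<j\le k$; $c_{2j}>c_{2j+1}$ for $k/2\le j<k$; and $c_1\ge c_{2k}$; it is a $(k,A)$-slow walk if $v_0\in A$. For distinct $a,b\in\{0,1\}^t$, $P(a,b)$ is the first position where they differ; $\{0,1\}^t$ is ordered lexicographically. Reversed thinning: $t=\lceil(\log_2 d)/2\rceil+1$; $H$ is the set of triples $(a,i,z)$ with $a\in\{0,1\}^t$,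 $i\in\{2,\dots,t\}$, $z\in\{1,\dots,2^i\}$, $a$ having $0$ in position $i$, ordered by $(a,i,z)<(b,j,s)$ iff $a<b$, or $a=b$ and $i>j$, or $(a,i)=(b,j)$ and $z<s$. A random $F:\{1,\dots,d\}\to H$ is chosen with $F(1)$ uniform among elements whose $a$ has first bit $0$ and $F(k)$ the successor of $F(k-1)$ in $H$. An edge $e$ with $F(\chi(e))=(a,i,z)$ has class $a$ and type $i$. Independent uniform $a_x\in\{0,1\}^t$ are chosen for all vertices. An edge $(x,y)$ of class $a$ and type $i$ is eligible if $a=a_y<a_x$ and $P(a,a_x)=i$; $E'$ consists of the eligible edges not adjacent to another eligible edge of the same type. The type edge coloring of $G'$ is $\chi'(e)=t+1-i$ for $e\in E'$ of type $i$ (a proper edge coloring). -}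

module Defs where

open import Data.Nat using (ℕ; zero; suc; _+_; _*_; _∸_; _^_; _≤_; _<_; ⌈_/2⌉)
open import Data.Nat.Logarithm using (⌈log₂_⌉)
open import Data.Bool using (Bool; true; false)
open import Data.Fin using (Fin)
open import Data.Vec using (Vec; []; _∷_)
open import Data.Sum using (_⊎_; inj₁; inj₂)
open import Data.Product using (Σ; _×_; _,_; proj₁; proj₂; ∃)
open import Data.Empty using (⊥)
open import Relation.Nullary using (¬_)
open import Relation.Binary.PropositionalEquality using (_≡_; _≢_)

-- The vertex set is the disjoint union A ⊎ B; an edge set is a
-- relation E : A → B → Set; an edge colouring is a function
-- χ : A → B → ℕ (only its values on edges matter).

module _ {nA nB : ℕ} where

  Vtx : Set
  Vtx = Fin nA ⊎ Fin nB

  Adj : (Fin nA → Fin nB → Set) → Vtx → Vtx → Set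
  Adj E (inj₁ x) (inj₂ y) = E x y
  Adj E (inj₂ y) (inj₁ x) = E x y
  Adj E _        _        = ⊥

  Col : (Fin nA → Fin nB → ℕ) → Vtx → Vtx → ℕ
  Col c (inj₁ x) (inj₂ y) = c x y
  Col c (inj₂ y) (inj₁ x) = c x y
  Col c _        _        = 0

  -- A walk v₀,…,v_m (values of v beyond m are irrelevant):
  -- consecutive vertices adjacent and v_{i-2} ≠ v_i.
  record Walk (E : Fin nA → Fin nB → Set) (m : ℕ) : Set where
    field
      v    : ℕ → Vtx
      adj  : ∀ i → i < m → Adj E (v i) (v (suc i))
      nobt : ∀ i → 2 + i ≤ m → v i ≢ v (2 + i)
  open Walk public

  -- the j-th edge colour c_j = colour of (v_{j-1}, v_j), for j ≥ 1
  wcol : {E : Fin nA → Fin nB → Set} {m : ℕ} →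
         (Fin nA → Fin nB → ℕ) → Walk E m → ℕ → ℕ
  wcol c w j = Col c (v w (j ∸ 1)) (v w j)

  IsFast : {E : Fin nA → Fin nB → Set} → (Fin nA → Fin nB → ℕ) →
           (k : ℕ) → Walk E (2 * k) → Set
  IsFast c k w =
    (∀ j → 1 ≤ j → j < k → wcol c w (suc j) < wcol c w j) ×
    (∀ j → k ≤ j → j < 2 * k → wcol c w j < wcol c w (suc j)) ×
    (wcol c w (2 * k) ≤ wcol c w 1)

  -- k-slow colouring condition on a walk of length 2k
  -- (j ≤ k/2 is written 2j ≤ k, etc.)
  IsSlow : {E : Fin nA → Fin nB → Set} → (Fin nA → Fin nB → ℕ) →
           (k : ℕ) → Walk E (2 * k) → Set
  IsSlow c k w =
    (∀ j → 1 ≤ j → 2 * j ≤ k → wcol c w (2 * j) < wcol c w (2 * j ∸ 1)) ×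
    (∀ j → 1 ≤ j → 2 * j < k → wcol c w (2 * j) < wcol c w (suc (2 * j))) ×
    (∀ j → k < 2 * j → j ≤ k → wcol c w (2 * j ∸ 1) < wcol c w (2 * j)) ×
    (∀ j → k ≤ 2 * j → j < k → wcol c w (suc (2 * j)) < wcol c w (2 * j)) ×
    (wcol c w (2 * k) ≤ wcol c w 1)

  InA : Vtx → Set
  InA u = Σ (Fin nA) λ x → u ≡ inj₁ x

  HasFastWalk : (Fin nA → Fin nB → Set) → (Fin nA → Fin nB → ℕ) → ℕ → Set
  HasFastWalk E c k = Σ (Walk E (2 * k)) λ w → IsFast c k w

  HasSlowAWalk : (Fin nA → Fin nB → Set) → (Fin nA → Fin nB → ℕ) → ℕ → Set
  HasSlowAWalk E c k = Σ (Walk E (2 * k)) λ w → InA (v w 0) × IsSlow c k w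

  ProperColoring : (Fin nA → Fin nB → Set) → (Fin nA → Fin nB → ℕ) → ℕ → Set
  ProperColoring E χ d =
    (∀ x y → E x y → 1 ≤ χ x y × χ x y ≤ d) ×
    (∀ x y y' → E x y → E x y' → χ x y ≡ χ x y' → y ≡ y') ×
    (∀ x x' y → E x y → E x' y → χ x y ≡ χ x' y → x ≡ x')

-- Bit strings {0,1}^t (false = 0, true = 1), positions 1-indexed.

LexLt : ∀ {n} → Vec Bool n → Vec Bool n → Set
LexLt []       []       = ⊥
LexLt (x ∷ a) (y ∷ b) = (x ≡ false × y ≡ true) ⊎ (x ≡ y × LexLt a b)

-- bit at position i (1-indexed); out of range positions give true
-- (only used for i within range)
bit : ∀ {n} → Vec Bool n → ℕ → Bool
bit []      _             = true
bit (x ∷ a) zero          = true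
bit (x ∷ a) (suc zero)    = x
bit (x ∷ a) (suc (suc i)) = bit a (suc i)

eqB : Bool → Bool → Bool
eqB false false = true
eqB true  true  = true
eqB _     _     = false

-- P(a,b): first position (1-indexed) where a and b differ
-- (only meaningful for a ≠ b)
P : ∀ {n} → Vec Bool n → Vec Bool n → ℕ
P []      []      = 0
P (x ∷ a) (y ∷ b) with eqB x y
... | true  = suc (P a b)
... | false = 1

-- t = ⌈(log₂ d)/2⌉ + 1   (note ⌈x/2⌉ = ⌈⌈x⌉/2⌉ for real x)
tOf : ℕ → ℕ
tOf d = ⌈ ⌈log₂ d ⌉ /2⌉ + 1

Triple : ℕ → Set
Triple t = Vec Bool t × ℕ × ℕ

cls : ∀ {t} → Triple t → Vec Bool t
cls (a , i , z) = a

typ : ∀ {t} → Triple t → ℕ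
typ (a , i , z) = i

InH : ∀ {t} → Triple t → Set
InH {t} (a , i , z) =
  2 ≤ i × i ≤ t × 1 ≤ z × z ≤ 2 ^ i × bit a i ≡ false

LtH : ∀ {t} → Triple t → Triple t → Set
LtH (a , i , z) (b , j , s) =
  LexLt a b ⊎ (a ≡ b × j < i) ⊎ (a ≡ b × i ≡ j × z < s)

IsSucc : ∀ {t} → Triple t → Triple t → Set
IsSucc h h' = InH h' × LtH h h' ×
  (∀ h'' → InH h'' → LtH h h'' → ¬ LtH h'' h')

-- F : {1,…,d} → H is a possible outcome of the random choice
ValidF : (d : ℕ) → (ℕ → Triple (tOf d)) → Set
ValidF d F =
  (InH (F 1) × bit (cls (F 1)) 1 ≡ false) ×
  (∀ k → 2 ≤ k → k ≤ d → IsSucc (F (k ∸ 1)) (F k))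

module _ {nA nB : ℕ} (d : ℕ) (E : Fin nA → Fin nB → Set)
         (χ : Fin nA → Fin nB → ℕ) (F : ℕ → Triple (tOf d))
         (la : Fin nA → Vec Bool (tOf d)) (lb : Fin nB → Vec Bool (tOf d)) where

  eclass : Fin nA → Fin nB → Vec Bool (tOf d)
  eclass x y = cls (F (χ x y))

  etype : Fin nA → Fin nB → ℕ
  etype x y = typ (F (χ x y))

  Eligible : Fin nA → Fin nB → Set
  Eligible x y = E x y × eclass x y ≡ lb y × LexLt (lb y) (la x) ×
                 P (eclass x y) (la x) ≡ etype x y

  ThinnedE : Fin nA → Fin nB → Set
  ThinnedE x y = Eligible x y ×
    (∀ y' → y' ≢ y → Eligible x y' → etype x y' ≢ etype x y) ×
    (∀ x' → x' ≢ x → Eligible x' y → etype x' y ≢ etype x y)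

  typeColoring : Fin nA → Fin nB → ℕ
  typeColoring x y = suc (tOf d) ∸ etype x y

-- Each colour c has a type ty c and a class cl c (the triple F c).  Along a walk in
-- G'' the two edges at a vertex of B share their class and their types are ordered
-- against their colours; at a vertex of A the types follow the colours and the class
-- rises from the lower to the higher coloured edge, first differing at the smaller
-- type (rise-A, fall-B, class-B).  Since χ' reverses types, a valley-shaped window of
-- a fast walk starting in A is χ'-slow as soon as its first type is at most its last
-- (valley-slow); with no smaller slow walks, this compares the types of symmetric
-- edges on the two arms of a fast walk (chain-A, chain-B, one of them through the
-- reversed walk).  Combining these comparisons with the class rises, an induction
-- outwards from the bottom edge (class-inv) shows cl c₁ <lex cl c₂ₖ (ends-rise).  But
-- c₂ₖ ≤ c₁ and F is increasing, so the class of c₂ₖ cannot exceed that of c₁.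
module Submission where

open import Defs
open import Data.Nat using (ℕ; zero; suc; _+_; _*_; _∸_; _≤_; _<_; z≤n; s≤s; _≤?_)
open import Data.Nat.Properties
open import Data.Bool using (Bool; true; false; not)
open import Data.Bool.Properties using (not-involutive)
open import Data.Fin using (Fin)
open import Data.Vec using (Vec; []; _∷_)
import Data.List as List
open import Data.Nat.Tactic.RingSolver using (solve)
open import Data.Sum using (inj₁; inj₂)
open import Data.Product using (Σ; _×_; _,_; proj₁; proj₂)
open import Data.Empty using (⊥; ⊥-elim)
open import Relation.Nullary using (¬_; yes; no)
open import Relation.Binary using (tri<; tri≈; tri>)
open import Relation.Binary.PropositionalEquality

FirstDiff : ∀ {n} → ℕ → Vec Bool n → Vec Bool n → Set
FirstDiff _             []      []      = ⊥
FirstDiff zero          (x ∷ a) (y ∷ b) = ⊥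
FirstDiff (suc zero)    (x ∷ a) (y ∷ b) = x ≡ false × y ≡ true
FirstDiff (suc (suc p)) (x ∷ a) (y ∷ b) = x ≡ y × FirstDiff (suc p) a b

lex-irrefl : ∀ {n} (a : Vec Bool n) → ¬ LexLt a a
lex-irrefl (x ∷ a) (inj₁ (refl , ()))
lex-irrefl (x ∷ a) (inj₂ (_ , a<a)) = lex-irrefl a a<a

lex-asym : ∀ {n} (a b : Vec Bool n) → LexLt a b → ¬ LexLt b a
lex-asym [] [] ()
lex-asym (x ∷ a) (y ∷ b) (inj₁ (refl , refl)) (inj₁ (() , _))
lex-asym (x ∷ a) (y ∷ b) (inj₁ (refl , refl)) (inj₂ (() , _))
lex-asym (x ∷ a) (y ∷ b) (inj₂ (refl , a<b)) (inj₁ (refl , ()))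
lex-asym (x ∷ a) (y ∷ b) (inj₂ (refl , a<b)) (inj₂ (_ , b<a)) = lex-asym a b a<b b<a

lex-trans : ∀ {n} (a b c : Vec Bool n) → LexLt a b → LexLt b c → LexLt a c
lex-trans [] [] [] ()
lex-trans (x ∷ a) (y ∷ b) (z ∷ c) (inj₁ (refl , refl)) (inj₁ (() , _))
lex-trans (x ∷ a) (y ∷ b) (z ∷ c) (inj₁ (refl , refl)) (inj₂ (refl , _)) = inj₁ (refl , refl)
lex-trans (x ∷ a) (y ∷ b) (z ∷ c) (inj₂ (refl , _)) (inj₁ (refl , refl)) = inj₁ (refl , refl)
lex-trans (x ∷ a) (y ∷ b) (z ∷ c) (inj₂ (refl , a<b)) (inj₂ (refl , b<c)) =
  inj₂ (refl , lex-trans a b c a<b b<c)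

firstDiff⇒lex : ∀ {n} p (a b : Vec Bool n) → FirstDiff p a b → LexLt a b
firstDiff⇒lex p             []      []      ()
firstDiff⇒lex (suc zero)    (x ∷ a) (y ∷ b) bits       = inj₁ bits
firstDiff⇒lex (suc (suc p)) (x ∷ a) (y ∷ b) (x≡y , fd) = inj₂ (x≡y , firstDiff⇒lex (suc p) a b fd)

firstDiff-cons : ∀ {n} x p (a b : Vec Bool n) → FirstDiff p a b → FirstDiff (suc p) (x ∷ a) (x ∷ b)
firstDiff-cons x p       []      []      ()
firstDiff-cons x zero    (y ∷ a) (z ∷ b) ()
firstDiff-cons x (suc p) (y ∷ a) (z ∷ b) fd = refl , fd

lex⇒firstDiff : ∀ {n} (a b : Vec Bool n) → LexLt a b → FirstDiff (P a b) a b
lex⇒firstDiff []          []           ()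
lex⇒firstDiff (false ∷ a) (true ∷ b)   (inj₁ (refl , refl)) = refl , refl
lex⇒firstDiff (false ∷ a) (.false ∷ b) (inj₂ (refl , a<b))  =
  firstDiff-cons false (P a b) a b (lex⇒firstDiff a b a<b)
lex⇒firstDiff (true ∷ a)  (.true ∷ b)  (inj₂ (refl , a<b))  =
  firstDiff-cons true (P a b) a b (lex⇒firstDiff a b a<b)

rebase-above : ∀ {n} p q (a b c : Vec Bool n) →
               FirstDiff p a b → FirstDiff q a c → q < p → FirstDiff q b c
rebase-above p q [] [] [] () _ _
rebase-above (suc zero) (suc zero) (x ∷ a) (y ∷ b) (z ∷ c) _ _ (s≤s ())
rebase-above (suc (suc p)) (suc zero) (x ∷ a) (y ∷ b) (z ∷ c) (refl , _) (refl , z≡1) _ = refl , z≡1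
rebase-above (suc (suc p)) (suc (suc q)) (x ∷ a) (y ∷ b) (z ∷ c) (refl , ab) (refl , ac) (s≤s q<p) =
  refl , rebase-above (suc p) (suc q) a b c ab ac q<p

rebase-below : ∀ {n} i j (a b c : Vec Bool n) →
               FirstDiff i a c → FirstDiff j b c → i < j → FirstDiff i a b
rebase-below i j [] [] [] () _ _
rebase-below (suc zero) (suc zero) (x ∷ a) (y ∷ b) (z ∷ c) _ _ (s≤s ())
rebase-below (suc zero) (suc (suc j)) (x ∷ a) (y ∷ b) (z ∷ c) (x≡0 , refl) (refl , _) _ = x≡0 , refl
rebase-below (suc (suc i)) (suc (suc j)) (x ∷ a) (y ∷ b) (z ∷ c) (refl , ac) (refl , bc) (s≤s i<j) =
  refl , rebase-below (suc i) (suc j) a b c ac bc i<j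

LtH-trans : ∀ {t} (h₁ h₂ h₃ : Triple t) → LtH h₁ h₂ → LtH h₂ h₃ → LtH h₁ h₃
LtH-trans (a , _) (b , _) (c , _) (inj₁ a<b) (inj₁ b<c) = inj₁ (lex-trans a b c a<b b<c)
LtH-trans _ _ _ (inj₁ a<b) (inj₂ (inj₁ (refl , _)))            = inj₁ a<b
LtH-trans _ _ _ (inj₁ a<b) (inj₂ (inj₂ (refl , _)))            = inj₁ a<b
LtH-trans _ _ _ (inj₂ (inj₁ (refl , _))) (inj₁ b<c)            = inj₁ b<c
LtH-trans _ _ _ (inj₂ (inj₂ (refl , _))) (inj₁ b<c)            = inj₁ b<c
LtH-trans _ _ _ (inj₂ (inj₁ (refl , j<i))) (inj₂ (inj₁ (refl , l<j))) = inj₂ (inj₁ (refl , <-trans l<j j<i))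
LtH-trans _ _ _ (inj₂ (inj₁ (refl , j<i))) (inj₂ (inj₂ (refl , refl , _))) = inj₂ (inj₁ (refl , j<i))
LtH-trans _ _ _ (inj₂ (inj₂ (refl , refl , _))) (inj₂ (inj₁ (refl , l<j))) = inj₂ (inj₁ (refl , l<j))
LtH-trans _ _ _ (inj₂ (inj₂ (refl , refl , z<s))) (inj₂ (inj₂ (refl , refl , s<r))) =
  inj₂ (inj₂ (refl , refl , <-trans z<s s<r))

LtH⇒¬class-down : ∀ {t} (h h' : Triple t) → LtH h h' → ¬ LexLt (cls h') (cls h)
LtH⇒¬class-down (a , _) (b , _) (inj₁ a<b)              b<a = lex-asym a b a<b b<a
LtH⇒¬class-down (a , _) (b , _) (inj₂ (inj₁ (refl , _))) b<a = lex-irrefl a b<a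
LtH⇒¬class-down (a , _) (b , _) (inj₂ (inj₂ (refl , _))) b<a = lex-irrefl a b<a

module Outcome (d : ℕ) (F : ℕ → Triple (tOf d)) (valid : ValidF d F) where

  F-inH : ∀ m → 1 ≤ m → m ≤ d → InH (F m)
  F-inH (suc zero)    _ _   = proj₁ (proj₁ valid)
  F-inH (suc (suc m)) _ m≤d = proj₁ (proj₂ valid (suc (suc m)) (s≤s (s≤s z≤n)) m≤d)

  F-step : ∀ n → 1 ≤ n → suc n ≤ d → LtH (F n) (F (suc n))
  F-step n 1≤n n<d = proj₁ (proj₂ (proj₂ valid (suc n) (s≤s 1≤n) n<d))

  F-mono : ∀ m n → 1 ≤ m → m < n → n ≤ d → LtH (F m) (F n)
  F-mono m (suc n) 1≤m (s≤s m≤n) n<d with m≤n⇒m<n∨m≡n m≤n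
  ... | inj₂ refl = F-step m 1≤m n<d
  ... | inj₁ m<n  = LtH-trans (F m) (F n) (F (suc n)) (F-mono m n 1≤m m<n (≤-trans (n≤1+n n) n<d))
                      (F-step n (≤-trans 1≤m m≤n) n<d)

  class-mono : ∀ m n → 1 ≤ n → n ≤ m → m ≤ d → ¬ LexLt (cls (F m)) (cls (F n))
  class-mono m n 1≤n n≤m m≤d m<n with m≤n⇒m<n∨m≡n n≤m
  ... | inj₂ refl = lex-irrefl _ m<n
  ... | inj₁ n<m  = LtH⇒¬class-down (F n) (F m) (F-mono n m 1≤n n<m m≤d) m<n

∸-split : ∀ {i N} → i < N → N ∸ i ≡ suc (N ∸ suc i)
∸-split {i} {N} i<N = +-∸-assoc 1 i<N

≤-by-offset : ∀ {a b} c → a + c ≡ b → a ≤ b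
≤-by-offset {a} c refl = m≤m+n a c

-- At level (n, l) of a fast walk of length 2k, where n + 1 + l + 1 = k, the
-- left edges l+1, l+2 and the right edges k+n, k+n+1, k+n+2 all exist.
level-left : ∀ {n l k} → suc n + suc l ≡ k → suc (suc l) ≤ k
level-left {n} {l} refl = ≤-by-offset n (solve (n List.∷ l List.∷ List.[]))

level-right : ∀ {n l k} → suc n + suc l ≡ k → suc (suc (k + n)) ≤ 2 * k
level-right {n} {l} refl = ≤-by-offset l (solve (n List.∷ l List.∷ List.[]))

-- at the bottom level k = l+1, and at the top level k = n+2
level-base : ∀ {l k} → suc l ≡ k → suc (suc l) ≤ 2 * k
level-base {l} refl = ≤-by-offset l (solve (l List.∷ List.[]))

level-end : ∀ {n k} → suc n + 1 ≡ k → suc (suc (k + n)) ≡ 2 * k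
level-end {n} refl = solve (n List.∷ List.[])

odd-positive : ∀ j → 1 ≤ 2 * suc j ∸ 1
odd-positive j = ≤-trans (s≤s z≤n) (m≤n+m (suc (j + 0)) j)

module _ {nA nB : ℕ} where

  inA? : Vtx {nA} {nB} → Bool
  inA? (inj₁ _) = true
  inA? (inj₂ _) = false

  inA?⇒InA : (u : Vtx {nA} {nB}) → inA? u ≡ true → InA u
  inA?⇒InA (inj₁ x) _ = x , refl

  Col-sym : (c : Fin nA → Fin nB → ℕ) (a b : Vtx) → Col c a b ≡ Col c b a
  Col-sym c (inj₁ x) (inj₁ y) = refl
  Col-sym c (inj₁ x) (inj₂ y) = refl
  Col-sym c (inj₂ y) (inj₁ x) = refl
  Col-sym c (inj₂ y) (inj₂ x) = refl

module _ {nA nB : ℕ} {E : Fin nA → Fin nB → Set} where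

  Adj-sym : ∀ a b → Adj E a b → Adj E b a
  Adj-sym (inj₁ x) (inj₂ y) e = e
  Adj-sym (inj₂ y) (inj₁ x) e = e

  side-flip : ∀ {N} (w : Walk E N) i → i < N → inA? (v w (suc i)) ≡ not (inA? (v w i))
  side-flip w i i<N = flip (v w i) (v w (suc i)) (adj w i i<N)
    where
      flip : ∀ a b → Adj E a b → inA? b ≡ not (inA? a)
      flip (inj₁ x) (inj₂ y) _ = refl
      flip (inj₂ y) (inj₁ x) _ = refl

  side-even : ∀ {N} (w : Walk E N) j → 2 * j ≤ N → inA? (v w (2 * j)) ≡ inA? (v w 0)
  side-even w zero    _       = refl
  side-even w (suc j) 2j+2≤N rewrite *-suc 2 j = begin
    inA? (v w (suc (suc (2 * j))))  ≡⟨ side-flip w (suc (2 * j)) 2j+2≤N ⟩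
    not (inA? (v w (suc (2 * j))))  ≡⟨ cong not (side-flip w (2 * j) (≤-trans (n≤1+n _) 2j+2≤N)) ⟩
    not (not (inA? (v w (2 * j))))  ≡⟨ not-involutive _ ⟩
    inA? (v w (2 * j))              ≡⟨ side-even w j (≤-trans (n≤1+n _) (≤-trans (n≤1+n _) 2j+2≤N)) ⟩
    inA? (v w 0)                    ∎
    where open ≡-Reasoning

  shift : ∀ {N} (w : Walk E N) (s n : ℕ) → n + s ≤ N → Walk E n
  shift {N} w s n n+s≤N = record
    { v    = λ i → v w (i + s)
    ; adj  = λ i i<n → adj w (i + s) (≤-trans (+-monoˡ-≤ s i<n) n+s≤N)
    ; nobt = λ i 2+i≤n → nobt w (i + s) (≤-trans (+-monoˡ-≤ s 2+i≤n) n+s≤N)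
    }

  reverse : ∀ {N} → Walk E N → Walk E N
  reverse {N} w = record
    { v    = λ i → v w (N ∸ i)
    ; adj  = λ i i<N → subst (λ m → Adj E (v w m) (v w (N ∸ suc i))) (sym (∸-split i<N))
                         (Adj-sym (v w (N ∸ suc i)) (v w (suc (N ∸ suc i))) (adj w (N ∸ suc i) (∸-suc-< i<N)))
    ; nobt = λ i 2+i≤N same →
        nobt w (N ∸ suc (suc i)) (subst (_≤ N) (∸-split2 2+i≤N) (m∸n≤m N i))
               (trans (sym same) (cong (v w) (∸-split2 2+i≤N)))
    }
    where
      ∸-suc-< : ∀ {i} → i < N → N ∸ suc i < N
      ∸-suc-< {i} i<N = subst (_≤ N) (∸-split i<N) (m∸n≤m N i)
      ∸-split2 : ∀ {i} → 2 + i ≤ N → N ∸ i ≡ 2 + (N ∸ (2 + i))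
      ∸-split2 {i} 2+i≤N = trans (∸-split (≤-trans (n≤1+n _) 2+i≤N)) (cong suc (∸-split 2+i≤N))

  reverse-col : ∀ {N} (w : Walk E N) (c : Fin nA → Fin nB → ℕ) {q j} → q + suc j ≡ N →
                wcol c (reverse w) (suc j) ≡ wcol c w (suc q)
  reverse-col w c {q} {j} refl = begin
    Col c (v w (q + suc j ∸ j)) (v w (q + suc j ∸ suc j)) ≡⟨ cong₂ (λ a b → Col c (v w a) (v w b)) left right ⟩
    Col c (v w (suc q)) (v w q)                           ≡⟨ Col-sym c (v w (suc q)) (v w q) ⟩
    wcol c w (suc q)                                      ∎
    where
      open ≡-Reasoning
      left : q + suc j ∸ j ≡ suc q
      left = trans (cong (_∸ j) (+-suc q j)) (m+n∸n≡m (suc q) j)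
      right : q + suc j ∸ suc j ≡ q
      right = m+n∸n≡m q (suc j)

  Descending : ∀ {N} → (Fin nA → Fin nB → ℕ) → ℕ → Walk E N → Set
  Descending c m w = ∀ j → 1 ≤ j → j < m → wcol c w (suc j) < wcol c w j

  Ascending : ∀ {N} → (Fin nA → Fin nB → ℕ) → ℕ → Walk E N → Set
  Ascending {N} c m w = ∀ j → m ≤ j → j < N → wcol c w j < wcol c w (suc j)

  Valley : ∀ {N} → (Fin nA → Fin nB → ℕ) → ℕ → Walk E N → Set
  Valley c m w = Descending c m w × Ascending c m w

  valley-window : ∀ {N} {c} {m} (w : Walk E N) → Valley c m w →
                  ∀ s h → h + s ≡ m → (bound : 2 * h + s ≤ N) → Valley c h (shift w s (2 * h) bound)
  valley-window {c = c} w (desc , asc) s h refl bound = desc' , asc'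
    where
      desc' : Descending c h (shift w s (2 * h) bound)
      desc' (suc j) _ j<h = desc (suc j + s) (s≤s z≤n) (+-monoˡ-< s j<h)
      asc' : Ascending c h (shift w s (2 * h) bound)
      asc' zero    z≤n ()
      asc' (suc j) h≤j j<2h = asc (suc j + s) (+-monoˡ-≤ s h≤j) (≤-trans (+-monoˡ-≤ s j<2h) bound)

  valley-reverse : ∀ {N} {c} {m m'} (w : Walk E N) → Valley c m w →
                   1 ≤ m → 1 ≤ m' → m' + m ≡ suc N → Valley c m' (reverse w)
  valley-reverse {N} {c} {m} {m'} w (desc , asc) 1≤m 1≤m' m'+m≡1+N = desc' , asc'
    where
      open ≤-Reasoning
      -- edges j+1 and j+2 of the reversed walk are edges q+2 and q+1 of w
      q : ℕ → ℕ
      q j = N ∸ (2 + j)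
      q-eq : ∀ {j} → 2 + j ≤ N → q j + (2 + j) ≡ N
      q-eq le = m∸n+n≡m le
      outer : ∀ {j} → 2 + j ≤ N → wcol c (reverse w) (suc (suc j)) ≡ wcol c w (suc (q j))
      outer le = reverse-col w c (q-eq le)
      inner : ∀ {j} → 2 + j ≤ N → wcol c (reverse w) (suc j) ≡ wcol c w (suc (suc (q j)))
      inner {j} le = reverse-col w c (trans (sym (+-suc (q j) (suc j))) (q-eq le))

      desc' : Descending c m' (reverse w)
      desc' (suc j) _ j<m' = subst₂ _<_ (sym (outer 2+j≤N)) (sym (inner 2+j≤N))
                               (asc (suc (q j)) m≤q+1 (≤-trans (s≤s (s≤s (m≤m+n (q j) j))) (≤-reflexive q+2+j≡N)))
        where
          m'≤N : m' ≤ N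
          m'≤N = +-cancelʳ-≤ 1 m' N (≤-trans (+-monoʳ-≤ m' 1≤m) (≤-reflexive (trans m'+m≡1+N (+-comm 1 N))))
          2+j≤N : 2 + j ≤ N
          2+j≤N = ≤-trans j<m' m'≤N
          q+2+j≡N : suc (suc (q j + j)) ≡ N
          q+2+j≡N = trans (sym (trans (+-suc (q j) (suc j)) (cong suc (+-suc (q j) j)))) (q-eq 2+j≤N)
          m≤q+1 : m ≤ suc (q j)
          m≤q+1 = +-cancelʳ-≤ (2 + j) m (suc (q j)) (begin
            m + (2 + j)       ≤⟨ +-monoʳ-≤ m j<m' ⟩
            m + m'            ≡⟨ +-comm m m' ⟩
            m' + m            ≡⟨ m'+m≡1+N ⟩
            suc N             ≡⟨ cong suc (sym (q-eq 2+j≤N)) ⟩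
            suc (q j) + (2 + j) ∎)

      asc' : Ascending c m' (reverse w)
      asc' zero    m'≤0 _   = ⊥-elim (1+n≰n (≤-trans 1≤m' m'≤0))
      asc' (suc j) m'≤j j<N = subst₂ _<_ (sym (inner j<N)) (sym (outer j<N))
                               (desc (suc (q j)) (s≤s z≤n) q+1<m)
        where
          q+1<m : 2 + q j ≤ m
          q+1<m = +-cancelʳ-≤ (suc j) (2 + q j) m (begin
            (2 + q j) + suc j  ≡⟨ cong suc (sym (+-suc (q j) (suc j))) ⟩
            suc (q j + (2 + j)) ≡⟨ cong suc (q-eq j<N) ⟩
            suc N              ≡⟨ sym m'+m≡1+N ⟩
            m' + m             ≤⟨ +-monoˡ-≤ m m'≤j ⟩
            suc j + m          ≡⟨ +-comm (suc j) m ⟩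
            m + suc j          ∎)

-- there are no 1-slow walks: their colouring would need c₁ < c₂ ≤ c₁
no-slow-one : ∀ {nA nB} {E : Fin nA → Fin nB → Set} (c : Fin nA → Fin nB → ℕ) (w : Walk E 2) → ¬ IsSlow c 1 w
no-slow-one c w (_ , _ , ascend , _ , end) = <⇒≱ (ascend 1 (s≤s (s≤s z≤n)) (s≤s z≤n)) end

data EdgesAt (m : ℕ) : ℕ → ℕ → Set where
  forward  : EdgesAt m m (suc m)
  backward : EdgesAt m (suc m) m

module Thinned {nA nB : ℕ} (E : Fin nA → Fin nB → Set) (χ : Fin nA → Fin nB → ℕ) (d : ℕ)
  (proper : ProperColoring E χ d) (F : ℕ → Triple (tOf d)) (valid : ValidF d F)
  (la : Fin nA → Vec Bool (tOf d)) (lb : Fin nB → Vec Bool (tOf d))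
  (E'' : Fin nA → Fin nB → Set) (E''⊆E' : ∀ x y → E'' x y → ThinnedE d E χ F la lb x y) where

  open Outcome d F valid

  t : ℕ
  t = tOf d

  χ' : Fin nA → Fin nB → ℕ
  χ' = typeColoring d E χ F la lb

  ty : ℕ → ℕ
  ty c = typ (F c)

  cl : ℕ → Vec Bool t
  cl c = cls (F c)

  colour-range : ∀ x y → E'' x y → 1 ≤ χ x y × χ x y ≤ d
  colour-range x y e = proj₁ proper x y (proj₁ (proj₁ (E''⊆E' x y e)))

  type-bound : ∀ x y → E'' x y → ty (χ x y) ≤ t
  type-bound x y e = proj₁ (proj₂ (F-inH (χ x y) (proj₁ range) (proj₂ range)))
    where range = colour-range x y e

  below-label : ∀ x y → E'' x y → FirstDiff (ty (χ x y)) (cl (χ x y)) (la x)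
  below-label x y e with proj₁ (E''⊆E' x y e)
  ... | _ , cls≡ay , ay<ax , P≡type =
    subst (λ p → FirstDiff p (cl (χ x y)) (la x)) P≡type
      (lex⇒firstDiff (cl (χ x y)) (la x) (subst (λ a → LexLt a (la x)) (sym cls≡ay) ay<ax))

  -- eligibility: all edges at y have the class a_y
  class-at-B : ∀ x x' y → E'' x y → E'' x' y → cl (χ x y) ≡ cl (χ x' y)
  class-at-B x x' y e e' = trans (proj₁ (proj₂ (proj₁ (E''⊆E' x y e))))
                                 (sym (proj₁ (proj₂ (proj₁ (E''⊆E' x' y e')))))

  ARise : ℕ → ℕ → Set
  ARise c c' = ty c < ty c' × FirstDiff (ty c) (cl c) (cl c')

  rise-at-A : ∀ x y y' → y ≢ y' → E'' x y → E'' x y' → χ x y < χ x y' → ARise (χ x y) (χ x y')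
  rise-at-A x y y' y≢y' e e' χ< with <-cmp (ty (χ x y)) (ty (χ x y'))
  ... | tri< ty< _ _ = ty< , rebase-below _ _ _ _ (la x) (below-label x y e) (below-label x y' e') ty<
  ... | tri≈ _ ty≡ _ = ⊥-elim (proj₁ (proj₂ (E''⊆E' x y e)) y' (λ y'≡y → y≢y' (sym y'≡y))
                                 (proj₁ (E''⊆E' x y' e')) (sym ty≡))
  ... | tri> _ _ ty> = ⊥-elim (LtH⇒¬class-down (F (χ x y)) (F (χ x y'))
                          (F-mono (χ x y) (χ x y') (proj₁ (colour-range x y e)) χ< (proj₂ (colour-range x y' e')))
                          (firstDiff⇒lex _ _ _ (rebase-below _ _ _ _ (la x) (below-label x y' e') (below-label x y e) ty>)))

  fall-at-B : ∀ x x' y → x ≢ x' → E'' x y → E'' x' y → χ x y < χ x' y → ty (χ x' y) < ty (χ x y)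
  fall-at-B x x' y x≢x' e e' χ< with F-mono (χ x y) (χ x' y) (proj₁ (colour-range x y e)) χ< (proj₂ (colour-range x' y e'))
  ... | inj₁ class< = ⊥-elim (lex-irrefl _ (subst (λ a → LexLt a (cl (χ x' y))) (class-at-B x x' y e e') class<))
  ... | inj₂ (inj₁ (_ , ty<)) = ty<
  ... | inj₂ (inj₂ (_ , ty≡ , _)) = ⊥-elim (proj₂ (proj₂ (E''⊆E' x y e)) x' (λ x'≡x → x≢x' (sym x'≡x))
                                      (proj₁ (E''⊆E' x' y e')) (sym ty≡))

  corner-rise-A : ∀ a b c → inA? b ≡ true → Adj E'' a b → Adj E'' c b → a ≢ c →
                  Col χ a b < Col χ c b → ARise (Col χ a b) (Col χ c b)
  corner-rise-A (inj₂ y) (inj₁ x) (inj₂ y') _ e e' a≢c = rise-at-A x y y' (λ y≡y' → a≢c (cong inj₂ y≡y')) e e'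
  corner-rise-A (inj₁ _) (inj₁ x) c        _ () _ _
  corner-rise-A (inj₂ y) (inj₁ x) (inj₁ _) _ _ () _
  corner-rise-A a        (inj₂ y) c        () _ _ _

  corner-fall-B : ∀ a b c → inA? b ≡ false → Adj E'' a b → Adj E'' c b → a ≢ c →
                  Col χ a b < Col χ c b → ty (Col χ c b) < ty (Col χ a b)
  corner-fall-B (inj₁ x) (inj₂ y) (inj₁ x') _ e e' a≢c = fall-at-B x x' y (λ x≡x' → a≢c (cong inj₁ x≡x')) e e'
  corner-fall-B (inj₂ _) (inj₂ y) c        _ () _ _
  corner-fall-B (inj₁ x) (inj₂ y) (inj₂ _) _ _ () _
  corner-fall-B a        (inj₁ x) c        () _ _ _

  corner-class-B : ∀ a b c → inA? b ≡ false → Adj E'' a b → Adj E'' c b → cl (Col χ a b) ≡ cl (Col χ c b)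
  corner-class-B (inj₁ x) (inj₂ y) (inj₁ x') _ e e' = class-at-B x x' y e e'
  corner-class-B (inj₂ _) (inj₂ y) c        _ () _
  corner-class-B (inj₁ x) (inj₂ y) (inj₂ _) _ _ ()
  corner-class-B a        (inj₁ x) c        () _ _

  Col-range : ∀ a b → Adj E'' a b → 1 ≤ Col χ a b × Col χ a b ≤ d
  Col-range (inj₁ x) (inj₂ y) e = colour-range x y e
  Col-range (inj₂ y) (inj₁ x) e = colour-range x y e

  Col-type-bound : ∀ a b → Adj E'' a b → ty (Col χ a b) ≤ t
  Col-type-bound (inj₁ x) (inj₂ y) e = type-bound x y e
  Col-type-bound (inj₂ y) (inj₁ x) e = type-bound x y e

  Col-χ' : ∀ a b → Adj E'' a b → Col χ' a b ≡ suc t ∸ ty (Col χ a b)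
  Col-χ' (inj₁ x) (inj₂ y) e = refl
  Col-χ' (inj₂ y) (inj₁ x) e = refl

  module Along {N : ℕ} (w : Walk E'' N) where

    col : ℕ → ℕ
    col = wcol χ w

    side : ℕ → Bool
    side i = inA? (v w i)

    after : ℕ → ℕ
    after i = Col χ (v w (suc (suc i))) (v w (suc i))

    col≡after : ∀ i → col (suc (suc i)) ≡ after i
    col≡after i = Col-sym χ (v w (suc i)) (v w (suc (suc i)))

    adj-back : ∀ i → suc i < N → Adj E'' (v w (suc (suc i))) (v w (suc i))
    adj-back i i<N = Adj-sym (v w (suc i)) (v w (suc (suc i))) (adj w (suc i) i<N)

    rise-A : ∀ {m p q} → EdgesAt m p q → 1 ≤ m → m < N → side m ≡ true → col p < col q → ARise (col p) (col q)
    rise-A {suc i} forward  _ m<N s = subst (λ c → col (suc i) < c → ARise (col (suc i)) c) (sym (col≡after i))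
      (corner-rise-A (v w i) (v w (suc i)) (v w (suc (suc i))) s (adj w i (<⇒≤ m<N))
         (adj-back i m<N) (nobt w i m<N))
    rise-A {suc i} backward _ m<N s = subst (λ c → c < col (suc i) → ARise c (col (suc i))) (sym (col≡after i))
      (corner-rise-A (v w (suc (suc i))) (v w (suc i)) (v w i) s (adj-back i m<N)
         (adj w i (<⇒≤ m<N)) (λ same → nobt w i m<N (sym same)))

    fall-B : ∀ {m p q} → EdgesAt m p q → 1 ≤ m → m < N → side m ≡ false → col p < col q → ty (col q) < ty (col p)
    fall-B {suc i} forward  _ m<N s = subst (λ c → col (suc i) < c → ty c < ty (col (suc i))) (sym (col≡after i))
      (corner-fall-B (v w i) (v w (suc i)) (v w (suc (suc i))) s (adj w i (<⇒≤ m<N))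
         (adj-back i m<N) (nobt w i m<N))
    fall-B {suc i} backward _ m<N s = subst (λ c → c < col (suc i) → ty (col (suc i)) < ty c) (sym (col≡after i))
      (corner-fall-B (v w (suc (suc i))) (v w (suc i)) (v w i) s (adj-back i m<N)
         (adj w i (<⇒≤ m<N)) (λ same → nobt w i m<N (sym same)))

    class-B : ∀ m → 1 ≤ m → m < N → side m ≡ false → cl (col m) ≡ cl (col (suc m))
    class-B (suc i) _ m<N s = trans (corner-class-B (v w i) (v w (suc i)) (v w (suc (suc i))) s
                                       (adj w i (<⇒≤ m<N)) (adj-back i m<N))
                                    (cong cl (sym (col≡after i)))

    edge-range : ∀ j → 1 ≤ j → j ≤ N → 1 ≤ col j × col j ≤ d
    edge-range (suc i) _ j≤N = Col-range (v w i) (v w (suc i)) (adj w i j≤N)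

    χ'-edge : ∀ j → 1 ≤ j → j ≤ N → wcol χ' w j ≡ suc t ∸ ty (col j)
    χ'-edge (suc i) _ j≤N = Col-χ' (v w i) (v w (suc i)) (adj w i j≤N)

    type-bound-edge : ∀ j → 1 ≤ j → j ≤ N → ty (col j) ≤ t
    type-bound-edge (suc i) _ j≤N = Col-type-bound (v w i) (v w (suc i)) (adj w i j≤N)

    χ'-flip : ∀ {p q} → 1 ≤ p → p ≤ N → 1 ≤ q → q ≤ N → ty (col p) < ty (col q) → wcol χ' w q < wcol χ' w p
    χ'-flip {p} {q} 1≤p p≤N 1≤q q≤N ty< = subst₂ _<_ (sym (χ'-edge q 1≤q q≤N)) (sym (χ'-edge p 1≤p p≤N))
      (∸-monoʳ-< ty< (≤-trans (type-bound-edge q 1≤q q≤N) (n≤1+n t)))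

    edges-in-range : ∀ {m p q} → EdgesAt m p q → 1 ≤ m → m < N → (1 ≤ p × p ≤ N) × (1 ≤ q × q ≤ N)
    edges-in-range forward  1≤m m<N = (1≤m , <⇒≤ m<N) , (s≤s z≤n , m<N)
    edges-in-range backward 1≤m m<N = (s≤s z≤n , m<N) , (1≤m , <⇒≤ m<N)

    χ'-at-B : ∀ {m p q} → EdgesAt m p q → 1 ≤ m → m < N → side m ≡ false → col p < col q → wcol χ' w p < wcol χ' w q
    χ'-at-B at 1≤m m<N s col< with edges-in-range at 1≤m m<N
    ... | (1≤p , p≤N) , (1≤q , q≤N) = χ'-flip 1≤q q≤N 1≤p p≤N (fall-B at 1≤m m<N s col<)

    χ'-at-A : ∀ {m p q} → EdgesAt m p q → 1 ≤ m → m < N → side m ≡ true → col p < col q → wcol χ' w q < wcol χ' w p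
    χ'-at-A at 1≤m m<N s col< with edges-in-range at 1≤m m<N
    ... | (1≤p , p≤N) , (1≤q , q≤N) = χ'-flip 1≤p p≤N 1≤q q≤N (proj₁ (rise-A at 1≤m m<N s col<))

    side-next : ∀ {m b} → m < N → side m ≡ b → side (suc m) ≡ not b
    side-next {m} m<N refl = side-flip w m m<N

    side-prev : ∀ {m b} → m < N → side (suc m) ≡ b → side m ≡ not b
    side-prev {m} m<N refl = begin
      side m                    ≡⟨ sym (not-involutive (side m)) ⟩
      not (not (side m))        ≡⟨ cong not (sym (side-flip w m m<N)) ⟩
      not (side (suc m))        ∎
      where open ≡-Reasoning

  open Along

  -- A valley-shaped walk of length 2h starting in A is an (h,A)-slow walk for χ',
  -- provided its first type does not exceed its last one: at each vertex the
  -- side decides whether χ' follows or reverses the order of χ.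
  valley-slow : ∀ h (u : Walk E'' (2 * h)) → 1 ≤ h → Valley χ h u → side u 0 ≡ true →
                ty (col u 1) ≤ ty (col u (2 * h)) → HasSlowAWalk E'' χ' h
  valley-slow h u 1≤h (desc , asc) start-A ty≤ = u , inA?⇒InA (v u 0) start-A , p1 , p2 , p3 , p4 , p5
    where
      h≤2h : h ≤ 2 * h
      h≤2h = m≤n*m h 2
      even-A : ∀ j → 2 * j ≤ 2 * h → side u (2 * j) ≡ true
      even-A j le = trans (side-even u j le) start-A
      p1 : ∀ j → 1 ≤ j → 2 * j ≤ h → wcol χ' u (2 * j) < wcol χ' u (2 * j ∸ 1)
      p1 (suc j) _ le = χ'-at-B u backward (odd-positive j) (≤-trans le h≤2h)
        (side-prev u (≤-trans le h≤2h) (even-A (suc j) (*-monoʳ-≤ 2 (≤-trans (m≤n*m (suc j) 2) le))))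
        (desc _ (odd-positive j) le)
      p2 : ∀ j → 1 ≤ j → 2 * j < h → wcol χ' u (2 * j) < wcol χ' u (suc (2 * j))
      p2 (suc j) _ lt = χ'-at-A u backward (s≤s z≤n) (≤-trans lt h≤2h)
        (even-A (suc j) (≤-trans (<⇒≤ lt) h≤2h)) (desc _ (s≤s z≤n) lt)
      p3 : ∀ j → h < 2 * j → j ≤ h → wcol χ' u (2 * j ∸ 1) < wcol χ' u (2 * j)
      p3 (suc j) lt le = χ'-at-B u forward (odd-positive j) (*-monoʳ-≤ 2 le)
        (side-prev u (*-monoʳ-≤ 2 le) (even-A (suc j) (*-monoʳ-≤ 2 le)))
        (asc _ (≤-pred lt) (*-monoʳ-≤ 2 le))
      p4 : ∀ j → h ≤ 2 * j → j < h → wcol χ' u (suc (2 * j)) < wcol χ' u (2 * j)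
      p4 zero    h≤0 _  = ⊥-elim (1+n≰n (≤-trans 1≤h h≤0))
      p4 (suc j) le  lt = χ'-at-A u forward (s≤s z≤n) (*-monoʳ-< 2 lt)
        (even-A (suc j) (<⇒≤ (*-monoʳ-< 2 lt))) (asc _ le (*-monoʳ-< 2 lt))
      p5 : wcol χ' u (2 * h) ≤ wcol χ' u 1
      p5 = subst₂ _≤_ (sym (χ'-edge u (2 * h) 1≤2h ≤-refl)) (sym (χ'-edge u 1 ≤-refl 1≤2h))
             (∸-monoʳ-≤ (suc t) ty≤)
        where
          1≤2h : 1 ≤ 2 * h
          1≤2h = ≤-trans 1≤h h≤2h

  NoSlowBelow : ℕ → Set
  NoSlowBelow k = ∀ h → 1 ≤ h → h < k → ¬ HasSlowAWalk E'' χ' h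

  window-types : ∀ {N m} (u : Walk E'' N) → Valley χ m u → ∀ s h → 1 ≤ h → h + s ≡ m →
                 2 * h + s ≤ N → side u s ≡ true → ¬ HasSlowAWalk E'' χ' h →
                 ty (col u (2 * h + s)) < ty (col u (suc s))
  window-types u valley s (suc h) _ h+s≡m bound start-A no-slow
    with ty (col u (suc s)) ≤? ty (col u (2 * suc h + s))
  ... | no  first≰last = ≰⇒> first≰last
  ... | yes first≤last = ⊥-elim (no-slow (valley-slow (suc h) window (s≤s z≤n)
                                 (valley-window u valley s (suc h) h+s≡m bound) start-A first≤last))
    where
      window : Walk E'' (2 * suc h)
      window = shift u s (2 * suc h) bound

  -- For suc n + suc l ≡ k, the edges l+1, k+n and the edges
  -- l+2, k+n+1 of a fast walk lie symmetrically around its bottom edge k; the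
  -- windows of length 2(n+1) between them compare their types.

  -- a window from the vertex l+1 (in A) to the vertex k+n+1 is not slow
  chain-B : ∀ {k} (w : Walk E'' (2 * k)) → Valley χ k w → NoSlowBelow k → ∀ n l → suc n + suc l ≡ k →
            side w (suc l) ≡ true → ty (col w (suc (k + n))) < ty (col w (suc (suc l)))
  chain-B w valley no-slow n l refl start-A = subst (λ e → ty (col w e) < ty (col w (suc (suc l)))) right-end
      (window-types w valley (suc l) (suc n) (s≤s z≤n) refl bound start-A
         (no-slow (suc n) (s≤s z≤n) (m<m+n (suc n) (s≤s z≤n))))
    where
      right-end : 2 * suc n + suc l ≡ suc (suc n + suc l + n)
      right-end = solve (n List.∷ l List.∷ List.[])
      bound : 2 * suc n + suc l ≤ 2 * (suc n + suc l)
      bound = ≤-by-offset (suc l) (solve (n List.∷ l List.∷ List.[]))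

  -- a window from the vertex k+n (in A) back to the vertex l is not slow
  chain-A : ∀ {k} (w : Walk E'' (2 * k)) → Valley χ k w → NoSlowBelow k → ∀ n l → suc n + suc l ≡ k →
            side w (k + n) ≡ true → ty (col w (suc l)) < ty (col w (k + n))
  chain-A w valley no-slow n l refl start-A = subst₂ (λ a b → ty a < ty b) left-end right-end
      (window-types (reverse w) (valley-reverse w valley (s≤s z≤n) (s≤s z≤n) mirror) (suc (suc l)) (suc n)
         (s≤s z≤n) fit bound start-A' (no-slow (suc n) (s≤s z≤n) (m<m+n (suc n) (s≤s z≤n))))
    where
      mirror : suc (suc n + suc l) + (suc n + suc l) ≡ suc (2 * (suc n + suc l))
      mirror = solve (n List.∷ l List.∷ List.[])
      fit : suc n + suc (suc l) ≡ suc (suc n + suc l)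
      fit = solve (n List.∷ l List.∷ List.[])
      bound : 2 * suc n + suc (suc l) ≤ 2 * (suc n + suc l)
      bound = ≤-by-offset l (solve (n List.∷ l List.∷ List.[]))
      left-sum : l + (2 * suc n + suc (suc l)) ≡ 2 * (suc n + suc l)
      left-sum = solve (n List.∷ l List.∷ List.[])
      right-sum : (n + suc l + n) + suc (suc (suc l)) ≡ 2 * (suc n + suc l)
      right-sum = solve (n List.∷ l List.∷ List.[])
      apex-sum : (suc n + suc l + n) + suc (suc l) ≡ 2 * (suc n + suc l)
      apex-sum = solve (n List.∷ l List.∷ List.[])
      start-A' : side (reverse w) (suc (suc l)) ≡ true
      start-A' = subst (λ m → inA? (v w m) ≡ true)
                   (sym (trans (cong (_∸ suc (suc l)) (sym apex-sum)) (m+n∸n≡m (suc n + suc l + n) (suc (suc l)))))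
                   start-A
      left-end : col (reverse w) (2 * suc n + suc (suc l)) ≡ col w (suc l)
      left-end = reverse-col w χ left-sum
      right-end : col (reverse w) (suc (suc (suc l))) ≡ col w (suc n + suc l + n)
      right-end = reverse-col w χ right-sum

  module FastWalk {k : ℕ} (w : Walk E'' (2 * k)) (valley : Valley χ k w) (no-slow : NoSlowBelow k) where

    Below : ℕ → ℕ → ℕ → Set
    Below p a b = FirstDiff (ty (col w p)) (cl (col w a)) (cl (col w b))

    Shape : Bool → ℕ → ℕ → Set
    Shape true  l r = Below r (suc l) (suc r)
    Shape false l r = Below (suc l) r l

    ClassInv : ℕ → ℕ → Set
    ClassInv l r = Σ Bool λ b → side w r ≡ b × side w (suc l) ≡ b × Shape b l r

    -- From side A at the edges l+2, r to side B at the edges l+1, r+1: the class of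
    -- the A-vertex l drops, and the chain inequality places the drop before edge r.
    step-A : ∀ n l → suc n + suc l ≡ k → 1 ≤ l → side w (k + n) ≡ true → side w (suc (suc l)) ≡ true →
             Shape true (suc l) (k + n) →
             side w (suc (k + n)) ≡ false × side w (suc l) ≡ false × Shape false l (suc (k + n))
    step-A n l lvl 1≤l sr s2 inv = side-next w r<2k sr , s1 ,
      rebase-above (ty (col w (k + n))) (ty (col w (suc l))) _ _ _
        (subst (λ a → FirstDiff (ty (col w (k + n))) a (cl (col w (suc (k + n))))) (sym same-class) inv)
        (proj₂ drop) (chain-A w valley no-slow n l lvl sr)
      where
        l+2≤k : suc (suc l) ≤ k
        l+2≤k = level-left lvl
        l+1<2k : suc l < 2 * k
        l+1<2k = ≤-trans l+2≤k (m≤n*m k 2)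
        r<2k : k + n < 2 * k
        r<2k = ≤-trans (n≤1+n _) (level-right lvl)
        s1 : side w (suc l) ≡ false
        s1 = side-prev w l+1<2k s2
        same-class : cl (col w (suc l)) ≡ cl (col w (suc (suc l)))
        same-class = class-B w (suc l) (s≤s z≤n) l+1<2k s1
        drop : ARise (col w (suc l)) (col w l)
        drop = rise-A w backward 1≤l (<⇒≤ l+1<2k) (side-prev w (<⇒≤ l+1<2k) s1)
                 (proj₁ valley l 1≤l (<⇒≤ l+2≤k))

    -- From side B at the edges l+2, r to side A at the edges l+1, r+1: the class of
    -- the A-vertex r+1 rises, and the chain inequality places the rise before edge l+2.
    step-B : ∀ n l → suc n + suc l ≡ k → side w (k + n) ≡ false → side w (suc (suc l)) ≡ false →
             Shape false (suc l) (k + n) →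
             side w (suc (k + n)) ≡ true × side w (suc l) ≡ true × Shape true l (suc (k + n))
    step-B n l lvl sr s2 inv = sr1 , s1 ,
      rebase-above (ty (col w (suc (suc l)))) (ty (col w (suc (k + n)))) _ _ _
        (subst (λ a → FirstDiff (ty (col w (suc (suc l)))) a (cl (col w (suc l)))) same-class inv)
        (proj₂ rise) (chain-B w valley no-slow n l lvl s1)
      where
        r+1<2k : suc (k + n) < 2 * k
        r+1<2k = level-right lvl
        1≤r : 1 ≤ k + n
        1≤r = ≤-trans (s≤s z≤n) (≤-trans (level-left lvl) (m≤m+n k n))
        sr1 : side w (suc (k + n)) ≡ true
        sr1 = side-next w (<⇒≤ r+1<2k) sr
        s1 : side w (suc l) ≡ true
        s1 = side-prev w (≤-trans (level-left lvl) (m≤n*m k 2)) s2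
        same-class : cl (col w (k + n)) ≡ cl (col w (suc (k + n)))
        same-class = class-B w (k + n) 1≤r (<⇒≤ r+1<2k) sr
        rise : ARise (col w (suc (k + n))) (col w (suc (suc (k + n))))
        rise = rise-A w forward (s≤s z≤n) r+1<2k sr1
                 (proj₂ valley (suc (k + n)) (≤-trans (m≤m+n k n) (n≤1+n _)) r+1<2k)

    -- At the bottom level the two edges at the vertex l+1 = k compare directly.
    base : ∀ l → suc l ≡ k → 1 ≤ l → ClassInv l (k + 0)
    base l lvl 1≤l = subst (ClassInv l) (trans lvl (sym (+-identityʳ k)))
                       (side w (suc l) , refl , refl , shape (side w (suc l)) refl)
      where
        l+1<2k : suc l < 2 * k
        l+1<2k = level-base lvl
        shape : ∀ b → side w (suc l) ≡ b → Shape b l (suc l)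
        shape true  s1 = proj₂ (rise-A w forward (s≤s z≤n) l+1<2k s1
                           (proj₂ valley (suc l) (≤-reflexive (sym lvl)) l+1<2k))
        shape false s1 = proj₂ (rise-A w backward 1≤l (<⇒≤ l+1<2k) (side-prev w (<⇒≤ l+1<2k) s1)
                           (proj₁ valley l 1≤l (≤-reflexive lvl)))

    class-inv : ∀ n l → suc n + l ≡ k → 1 ≤ l → ClassInv l (k + n)
    class-inv zero    l lvl 1≤l = base l lvl 1≤l
    class-inv (suc n) l lvl 1≤l = subst (ClassInv l) (sym (+-suc k n))
                                    (step (class-inv n (suc l) lvl' (s≤s z≤n)))
      where
        lvl' : suc n + suc l ≡ k
        lvl' = trans (cong suc (+-suc n l)) lvl
        step : ClassInv (suc l) (k + n) → ClassInv l (suc (k + n))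
        step (true  , sr , s2 , inv) = false , step-A n l lvl' 1≤l sr s2 inv
        step (false , sr , s2 , inv) = true  , step-B n l lvl' sr s2 inv

    ends-rise : 2 ≤ k → LexLt (cl (col w 1)) (cl (col w (2 * k)))
    ends-rise 2≤k with m≤n⇒∃[o]m+o≡n 2≤k
    ... | n , 2+n≡k = subst (λ e → LexLt (cl (col w 1)) (cl (col w e))) (level-end lvl)
                        (outer (class-inv n 1 lvl (s≤s z≤n)))
      where
        lvl : suc n + 1 ≡ k
        lvl = trans (cong suc (+-comm n 1)) 2+n≡k
        r+1<2k : suc (k + n) < 2 * k
        r+1<2k = level-right lvl
        1<2k : 1 < 2 * k
        1<2k = ≤-trans 2≤k (m≤n*m k 2)
        -- on side A the vertices 1 and 2k−1 lie in B, where classes do not change;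
        -- on side B one more step reaches the end edges
        outer : ClassInv 1 (k + n) → LexLt (cl (col w 1)) (cl (col w (suc (suc (k + n)))))
        outer (true  , sr , s2 , inv) = firstDiff⇒lex _ _ _ (subst₂ (FirstDiff (ty (col w (k + n)))) first last inv)
          where
            first : cl (col w 2) ≡ cl (col w 1)
            first = sym (class-B w 1 (s≤s z≤n) 1<2k (side-prev w 1<2k s2))
            last : cl (col w (suc (k + n))) ≡ cl (col w (suc (suc (k + n))))
            last = class-B w (suc (k + n)) (s≤s z≤n) r+1<2k (side-next w (<⇒≤ r+1<2k) sr)
        outer (false , sr , s2 , inv) = firstDiff⇒lex _ _ _ (proj₂ (proj₂ (step-B n 0 lvl sr s2 inv)))

-- A fast walk is a valley whose end colours satisfy c₂ₖ ≤ c₁, so the class of c₂ₖ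
-- cannot lie above that of c₁; yet ends-rise says it does.
lemma9 : (nA nB : ℕ) (E : Fin nA → Fin nB → Set) (χ : Fin nA → Fin nB → ℕ) (d : ℕ) →
    2 ≤ d → ProperColoring E χ d →
    (F : ℕ → Triple (tOf d)) → ValidF d F →
    (la : Fin nA → Vec Bool (tOf d)) (lb : Fin nB → Vec Bool (tOf d)) →
    (k : ℕ) → 2 ≤ k →
    (E'' : Fin nA → Fin nB → Set) →
    (∀ x y → E'' x y → ThinnedE d E χ F la lb x y) →
    (∀ k' → 2 ≤ k' → k' < k → ¬ HasSlowAWalk E'' (typeColoring d E χ F la lb) k') →
    ¬ HasFastWalk E'' χ k
lemma9 nA nB E χ d _ proper F valid la lb k 2≤k E'' E''⊆E' no-slow (w , descend , ascend , end) =
  class-mono (col w 1) (col w (2 * k)) (proj₁ last-range) end (proj₂ first-range) (ends-rise 2≤k)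
  where
    open Outcome d F valid
    open Thinned E χ d proper F valid la lb E'' E''⊆E'
    open Along
    -- the hypothesis covers h ≥ 2, and 1-slow walks do not exist at all
    no-slow-below : NoSlowBelow k
    no-slow-below (suc zero)    _ _   (u , _ , slow) = no-slow-one χ' u slow
    no-slow-below (suc (suc h)) _ h<k                = no-slow (suc (suc h)) (s≤s (s≤s z≤n)) h<k
    open FastWalk w (descend , ascend) no-slow-below
    first-range : 1 ≤ col w 1 × col w 1 ≤ d
    first-range = edge-range w 1 ≤-refl (≤-trans (s≤s z≤n) (≤-trans 2≤k (m≤n*m k 2)))
    last-range : 1 ≤ col w (2 * k) × col w (2 * k) ≤ d
    last-range = edge-range w (2 * k) (≤-trans (s≤s z≤n) (≤-trans 2≤k (m≤n*m k 2))) ≤-refl
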